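{- Let $V=\{v_1,\dots,v_n\}$ and let $\Delta$ be a pure simplicial complex on $V$ of dimension $d$ with $d>1$. If $\Delta$ is a quasi $f$-simplicial complex, then $\Delta$ is connected.
   Context: A simplicial complex on $V$ is a collection $\Delta$ of subsets of $V$ containing every singleton $\{v\}$, $v\in V$, and closed under taking subsets; maximal faces are facets, $\dim F=|F|-1$, and $\Delta$ is pure if all facets have the same dimension. $\Delta$ is connected if for any two facets $F,F'$ there is a sequence of facets $F=F_0,F_1,\dots,F_r=F'$ with $F_i\cap F_{i+1}\neq\emptyset$ for $0\le i\le r-1$. Let $k$ be a field, $R=k[x_1,\dots,x_n]$, and $x_F=\prod_{v_i\in F}x_i$. The facet ideal of $\Delta$ is $I_{\mathcal F}(\Delta)=(x_F: F \text{ a facet of } \Delta)$. For a square-free monomial ideal $I\subseteq R$ with minimal monomial generating set $G(I)$: the facet complex $\delta_{\mathcal F}(I)$ is the simplicial complex whose facets are the sets $\{v_{i_1},\dots,v_{i_r}\}$ with $x_{i_1}\cdots x_{i_r}\in G(I)$; the non-face complex $\delta_{\mathcal N}(I)$ is $\{F\subseteq V: x_F\notin I\}$. The $f$-vector of a $d$-dimensional complex is $(f_0,\dots,f_d)$, $f_i$ the number of faces with $i+1$ elements. $I$ is a quasi $f$-ideal of type $(a_1,\dots,a_s)\in\mathbb Z^s$ if $f(\delta_{\mathcal N}(I))-f(\delta_{\mathcal F}(I))=(a_1,\dots,a_s)$, both $f$-vectors lying in $\mathbb Z^s$. $\Delta$ is a quasi $f$-simplicial complex (of type $(a_1,\dots,a_s)$)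 if $I_{\mathcal F}(\Delta)$ is a quasi $f$-ideal (of type $(a_1,\dots,a_s)$) in $R$. -}

module Defs where

open import Data.Nat as ℕ using (ℕ; zero; suc; _<_; _≟_)
open import Data.Integer as ℤ using (ℤ; +_; _-_)
open import Data.Bool using (true; false)
open import Data.Fin using (Fin)
open import Data.Fin.Subset using (Subset; _⊆_; _∈_; ∣_∣; ⁅_⁆; inside; outside)
open import Data.Fin.Subset.Properties using (_⊆?_; anySubset?)
open import Data.List using (List; []; _∷_; _++_; map; filter; length; foldr; upTo; zipWith)
open import Data.List.Relation.Unary.Any using (Any; any?)
open import Data.Vec using ([]; _∷_)
open import Data.Vec.Properties using (≡-dec)
open import Data.Bool.Properties using () renaming (_≟_ to _≟ᵇ_)
open import Data.Product using (Σ; ∃; ∃-syntax; _×_; _,_)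
open import Data.Product.Properties using ()
open import Relation.Nullary using (Dec; yes; no; ¬_)
open import Relation.Nullary.Decidable using (_×-dec_; ¬?)
open import Relation.Unary using (Pred; Decidable)
open import Relation.Binary.PropositionalEquality using (_≡_)
open import Data.Empty using (⊥-elim)
import Level

-- Vertex set V = {v_1,…,v_n} is Fin n; a subset F ⊆ V is a 'Subset n'
-- (and corresponds to the square-free monomial x_F).

allSubsets : (n : ℕ) → List (Subset n)
allSubsets zero = [] ∷ []
allSubsets (suc n) = map (inside ∷_) (allSubsets n) ++ map (outside ∷_) (allSubsets n)

_≟ˢ_ : {n : ℕ} → (F G : Subset n) → Dec (F ≡ G)
_≟ˢ_ = ≡-dec _≟ᵇ_

record SimplicialComplex (n : ℕ) : Set₁ where
  field
    face       : Subset n → Set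
    face?      : Decidable face
    singletons : (v : Fin n) → face ⁅ v ⁆
    downClosed : {F G : Subset n} → G ⊆ F → face F → face G
open SimplicialComplex public

IsFacet : {n : ℕ} → SimplicialComplex n → Subset n → Set
IsFacet Δ F = face Δ F × ((G : Subset _) → face Δ G → F ⊆ G → G ≡ F)

IsFacet? : {n : ℕ} (Δ : SimplicialComplex n) → Decidable (IsFacet Δ)
IsFacet? Δ F with face? Δ F
... | no ¬f = no (λ { (f , _) → ¬f f })
... | yes f with anySubset? (λ G → face? Δ G ×-dec ((F ⊆? G) ×-dec ¬? (G ≟ˢ F)))
...   | yes (G , fG , F⊆G , G≢F) = no (λ { (_ , mx) → G≢F (mx G fG F⊆G) })
...   | no ¬bad = yes (f , λ G fG F⊆G → dec G fG F⊆G)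
  where
    dec : (G : Subset _) → face Δ G → F ⊆ G → G ≡ F
    dec G fG F⊆G with G ≟ˢ F
    ... | yes eq = eq
    ... | no neq = ⊥-elim (¬bad (G , fG , F⊆G , neq))

-- dim F = |F| - 1 ; Δ is pure of dimension d: it has a facet of
-- dimension d and every facet has dimension d
IsPureOfDim : {n : ℕ} → SimplicialComplex n → ℕ → Set
IsPureOfDim Δ d =
  (∃[ F ] (IsFacet Δ F × ∣ F ∣ ≡ suc d)) ×
  ((F : Subset _) → IsFacet Δ F → ∣ F ∣ ≡ suc d)

Meet : {n : ℕ} → Subset n → Subset n → Set
Meet F G = ∃[ v ] (v ∈ F × v ∈ G)

data FacetChain {n : ℕ} (Δ : SimplicialComplex n) : Subset n → Subset n → Set where
  stop : {F : Subset n} → FacetChain Δ F F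
  step : {F G F' : Subset n} → IsFacet Δ G → Meet F G → FacetChain Δ G F' → FacetChain Δ F F'

Connected : {n : ℕ} → SimplicialComplex n → Set
Connected Δ = (F F' : Subset _) → IsFacet Δ F → IsFacet Δ F' → FacetChain Δ F F'

-- Square-free monomial ideals of R = k[x_1,…,x_n], given by a finite
-- list of square-free monomial generators x_G (G : Subset n).
-- A square-free monomial x_F lies in the ideal iff some generator x_G
-- divides x_F, i.e. G ⊆ F.

SqFreeMonomialIdeal : ℕ → Set
SqFreeMonomialIdeal n = List (Subset n)

_∈ᴵ_ : {n : ℕ} → Subset n → SqFreeMonomialIdeal n → Set
F ∈ᴵ I = Any (_⊆ F) I

_∈ᴵ?_ : {n : ℕ} → (F : Subset n) → (I : SqFreeMonomialIdeal n) → Dec (F ∈ᴵ I)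
F ∈ᴵ? I = any? (_⊆? F) I

InMinGens : {n : ℕ} → SqFreeMonomialIdeal n → Subset n → Set
InMinGens I F = F ∈ᴵ I × ((H : Subset _) → H ∈ᴵ I → H ⊆ F → H ≡ F)

InMinGens? : {n : ℕ} (I : SqFreeMonomialIdeal n) → Decidable (InMinGens I)
InMinGens? I F with F ∈ᴵ? I
... | no ¬m = no (λ { (m , _) → ¬m m })
... | yes m with anySubset? (λ H → (H ∈ᴵ? I) ×-dec ((H ⊆? F) ×-dec ¬? (H ≟ˢ F)))
...   | yes (H , mH , H⊆F , H≢F) = no (λ { (_ , mn) → H≢F (mn H mH H⊆F) })
...   | no ¬bad = yes (m , dec)
  where
    dec : (H : Subset _) → H ∈ᴵ I → H ⊆ F → H ≡ F
    dec H mH H⊆F with H ≟ˢ F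
    ... | yes eq = eq
    ... | no neq = ⊥-elim (¬bad (H , mH , H⊆F , neq))

facetIdeal : {n : ℕ} → SimplicialComplex n → SqFreeMonomialIdeal n
facetIdeal {n} Δ = filter (IsFacet? Δ) (allSubsets n)

FacetComplexFace : {n : ℕ} → SqFreeMonomialIdeal n → Subset n → Set
FacetComplexFace I F = ∃[ G ] (InMinGens I G × F ⊆ G)

FacetComplexFace? : {n : ℕ} (I : SqFreeMonomialIdeal n) → Decidable (FacetComplexFace I)
FacetComplexFace? I F = anySubset? (λ G → InMinGens? I G ×-dec (F ⊆? G))

NonFaceComplexFace : {n : ℕ} → SqFreeMonomialIdeal n → Subset n → Set
NonFaceComplexFace I F = ¬ (F ∈ᴵ I)

NonFaceComplexFace? : {n : ℕ} (I : SqFreeMonomialIdeal n) → Decidable (NonFaceComplexFace I)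
NonFaceComplexFace? I F = ¬? (F ∈ᴵ? I)

countFaces : {n : ℕ} {P : Pred (Subset n) Level.zero} → Decidable P → ℕ → ℕ
countFaces {n} P? k = length (filter (λ F → P? F ×-dec (∣ F ∣ ≟ k)) (allSubsets n))

maxFaceSize : {n : ℕ} {P : Pred (Subset n) Level.zero} → Decidable P → ℕ
maxFaceSize {n} P? = foldr ℕ._⊔_ 0 (map ∣_∣ (filter P? (allSubsets n)))

-- f-vector (f_0,…,f_d), d the dimension; f_i = #faces with i+1 elements
fVector : {n : ℕ} {P : Pred (Subset n) Level.zero} → Decidable P → List ℕ
fVector P? = map (λ i → countFaces P? (suc i)) (upTo (maxFaceSize P?))

-- I is a quasi f-ideal of type a = (a_1,…,a_s):
-- f(δ_N(I)) - f(δ_F(I)) = a with both f-vectors in ℤ^s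
IsQuasiFIdealOfType : {n : ℕ} → SqFreeMonomialIdeal n → List ℤ → Set
IsQuasiFIdealOfType I a =
  let fN = fVector (NonFaceComplexFace? I)
      fF = fVector (FacetComplexFace? I)
  in length fN ≡ length a × length fF ≡ length a ×
     a ≡ zipWith (λ x y → + x - + y) fN fF

IsQuasiFIdeal : {n : ℕ} → SqFreeMonomialIdeal n → Set
IsQuasiFIdeal I = ∃[ a ] IsQuasiFIdealOfType I a

IsQuasiFSimplicialComplex : {n : ℕ} → SimplicialComplex n → Set
IsQuasiFSimplicialComplex Δ = IsQuasiFIdeal (facetIdeal Δ)

-- The length of an f-vector is the dimension plus one. If a set X with
-- x_X ∉ I_F(Δ) had more than d + 1 elements, the non-face complex would have
-- larger dimension than the facet complex, whose faces are the faces of Δ, and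
-- the two f-vectors could not have the same length. Hence every set of at
-- least d + 2 vertices contains a facet. For disjoint facets F, F' drop one
-- vertex from each: the union has 2d ≥ d + 2 vertices, so it contains a facet
-- G, and G (having d + 1 vertices) lies in neither half, so it meets both.
module Submission where

open import Defs
open import Data.Nat using (ℕ; zero; suc; _+_; _≤_; _<_; _⊔_; z≤n; s≤s)
open import Data.Nat.Properties
  using (≤-trans; ≤-reflexive; <-irrefl; n≤1+n; ≤-pred; +-suc; +-comm; +-mono-≤; +-monoʳ-≤;
         m≤m⊔n; m≤n⊔m; ⊔-lub; <-≤-trans)
open import Data.Bool using (true; false)
open import Data.Fin using (Fin)
import Data.Fin as Fin
open import Data.Fin.Subset
  using (Subset; _⊆_; _∈_; ∣_∣; inside; outside; _∪_; _∩_; _-_; Nonempty; Empty)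
open import Data.Fin.Subset.Properties
  using (nonempty?; Empty-unique; ∣⊥∣≡0; p─⊥≡p; x∈p∩q⁺; x∈p∩q⁻; x∈p∪q⁻; ∪-comm; p─q⊆p;
         p⊆q⇒∣p∣≤∣q∣; x∈p⇒∣p-x∣<∣p∣)
open import Data.Vec using ([]; _∷_; here; there)
open import Data.List using (List; []; _∷_; map; filter; length; foldr; upTo)
open import Data.List.Properties using (length-map; length-upTo)
open import Data.List.Membership.Propositional using (find; lose) renaming (_∈_ to _∈ₗ_)
open import Data.List.Membership.Propositional.Properties
  using (∈-map⁺; ∈-++⁺ˡ; ∈-++⁺ʳ; ∈-filter⁺; ∈-filter⁻)
open import Data.List.Relation.Unary.Any using (here; there)
open import Data.Product using (∃-syntax; _×_; _,_; proj₂)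
open import Data.Sum using (inj₁; inj₂)
open import Data.Empty using (⊥-elim)
open import Relation.Nullary using (yes; no)
open import Relation.Unary using (Pred; Decidable)
open import Relation.Binary.PropositionalEquality using (_≡_; refl; sym; trans; cong; subst)
open import Level using (0ℓ)

private
  variable
    n : ℕ

∈-allSubsets : (p : Subset n) → p ∈ₗ allSubsets n
∈-allSubsets {zero}  []          = here refl
∈-allSubsets {suc n} (true ∷ p)  = ∈-++⁺ˡ (∈-map⁺ (inside ∷_) (∈-allSubsets p))
∈-allSubsets {suc n} (false ∷ p) =
  ∈-++⁺ʳ (map (inside ∷_) (allSubsets n)) (∈-map⁺ (outside ∷_) (∈-allSubsets p))

≤-foldr-⊔ : {A : Set} (f : A → ℕ) {xs : List A} {x : A} → x ∈ₗ xs → f x ≤ foldr _⊔_ 0 (map f xs)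
≤-foldr-⊔ f {y ∷ _} (here refl) = m≤m⊔n (f y) _
≤-foldr-⊔ f {y ∷ _} (there x∈)  = ≤-trans (≤-foldr-⊔ f x∈) (m≤n⊔m (f y) _)

foldr-⊔-≤ : {A : Set} (f : A → ℕ) (xs : List A) {b : ℕ} →
            (∀ {x} → x ∈ₗ xs → f x ≤ b) → foldr _⊔_ 0 (map f xs) ≤ b
foldr-⊔-≤ f []       bound = z≤n
foldr-⊔-≤ f (y ∷ ys) bound = ⊔-lub (bound (here refl)) (foldr-⊔-≤ f ys (λ x∈ → bound (there x∈)))

0<∣p∣⇒Nonempty : (p : Subset n) → 0 < ∣ p ∣ → Nonempty p
0<∣p∣⇒Nonempty {n} p 0<∣p∣ with nonempty? p
... | yes ne = ne
... | no  ¬ne = ⊥-elim (<-irrefl (sym (trans (cong ∣_∣ (Empty-unique ¬ne)) (∣⊥∣≡0 n))) 0<∣p∣)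

∣p∣≤1+∣p-x∣ : (p : Subset n) (x : Fin n) → ∣ p ∣ ≤ suc ∣ p - x ∣
∣p∣≤1+∣p-x∣ (true  ∷ p) Fin.zero    = s≤s (≤-reflexive (cong ∣_∣ (sym (p─⊥≡p p))))
∣p∣≤1+∣p-x∣ (false ∷ p) Fin.zero    = ≤-trans (≤-reflexive (cong ∣_∣ (sym (p─⊥≡p p)))) (n≤1+n _)
∣p∣≤1+∣p-x∣ (true  ∷ p) (Fin.suc x) = s≤s (∣p∣≤1+∣p-x∣ p x)
∣p∣≤1+∣p-x∣ (false ∷ p) (Fin.suc x) = ∣p∣≤1+∣p-x∣ p x

∣p∣+∣q∣≤∣p∪q∣ : (p q : Subset n) → Empty (p ∩ q) → ∣ p ∣ + ∣ q ∣ ≤ ∣ p ∪ q ∣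
∣p∣+∣q∣≤∣p∪q∣ []          []          _      = z≤n
∣p∣+∣q∣≤∣p∪q∣ (true  ∷ p) (true  ∷ q) p∩q=∅ = ⊥-elim (p∩q=∅ (Fin.zero , here))
∣p∣+∣q∣≤∣p∪q∣ (true  ∷ p) (false ∷ q) p∩q=∅ = s≤s (∣p∣+∣q∣≤∣p∪q∣ p q (λ (i , i∈) → p∩q=∅ (Fin.suc i , there i∈)))
∣p∣+∣q∣≤∣p∪q∣ (false ∷ p) (true  ∷ q) p∩q=∅ =
  subst (_≤ suc ∣ p ∪ q ∣) (sym (+-suc ∣ p ∣ ∣ q ∣))
        (s≤s (∣p∣+∣q∣≤∣p∪q∣ p q (λ (i , i∈) → p∩q=∅ (Fin.suc i , there i∈))))
∣p∣+∣q∣≤∣p∪q∣ (false ∷ p) (false ∷ q) p∩q=∅ = ∣p∣+∣q∣≤∣p∪q∣ p q (λ (i , i∈) → p∩q=∅ (Fin.suc i , there i∈))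

⊆∪-∣p∣<⇒meets : (p q r : Subset n) → r ⊆ p ∪ q → ∣ p ∣ < ∣ r ∣ → Nonempty (r ∩ q)
⊆∪-∣p∣<⇒meets p q r r⊆p∪q ∣p∣<∣r∣ with nonempty? (r ∩ q)
... | yes meets = meets
... | no  r∩q=∅ = ⊥-elim (<-irrefl refl (<-≤-trans ∣p∣<∣r∣ (p⊆q⇒∣p∣≤∣q∣ r⊆p)))
  where
    r⊆p : r ⊆ p
    r⊆p i∈r with x∈p∪q⁻ p q (r⊆p∪q i∈r)
    ... | inj₁ i∈p = i∈p
    ... | inj₂ i∈q = ⊥-elim (r∩q=∅ (_ , x∈p∩q⁺ (i∈r , i∈q)))

module _ {P : Pred (Subset n) 0ℓ} (P? : Decidable P) where

  ∣F∣≤maxFaceSize : {F : Subset n} → P F → ∣ F ∣ ≤ maxFaceSize P?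
  ∣F∣≤maxFaceSize {F} PF = ≤-foldr-⊔ ∣_∣ (∈-filter⁺ P? (∈-allSubsets F) PF)

  maxFaceSize≤ : {b : ℕ} → (∀ {F} → P F → ∣ F ∣ ≤ b) → maxFaceSize P? ≤ b
  maxFaceSize≤ bound = foldr-⊔-≤ ∣_∣ (filter P? (allSubsets n))
    (λ F∈ → bound (proj₂ (∈-filter⁻ P? {xs = allSubsets n} F∈)))

  length-fVector : length (fVector P?) ≡ maxFaceSize P?
  length-fVector = trans (length-map _ (upTo (maxFaceSize P?))) (length-upTo _)

quasiF⇒maxFaceSize-≡ : {I : SqFreeMonomialIdeal n} {a : List _} → IsQuasiFIdealOfType I a →
  maxFaceSize (NonFaceComplexFace? I) ≡ maxFaceSize (FacetComplexFace? I)
quasiF⇒maxFaceSize-≡ {I = I} (∣fN∣≡∣a∣ , ∣fF∣≡∣a∣ , _) = begin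
  maxFaceSize (NonFaceComplexFace? I)    ≡⟨ sym (length-fVector (NonFaceComplexFace? I)) ⟩
  length (fVector (NonFaceComplexFace? I)) ≡⟨ trans ∣fN∣≡∣a∣ (sym ∣fF∣≡∣a∣) ⟩
  length (fVector (FacetComplexFace? I))   ≡⟨ length-fVector (FacetComplexFace? I) ⟩
  maxFaceSize (FacetComplexFace? I)      ∎
  where open Relation.Binary.PropositionalEquality.≡-Reasoning

quasiF⇒large-∈ᴵ : {I : SqFreeMonomialIdeal n} → IsQuasiFIdeal I → {b : ℕ} →
  (∀ {F} → FacetComplexFace I F → ∣ F ∣ ≤ b) → (X : Subset n) → b < ∣ X ∣ → X ∈ᴵ I
quasiF⇒large-∈ᴵ {I = I} (_ , quasi) bound X b<∣X∣ with X ∈ᴵ? I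
... | yes X∈I = X∈I
... | no  X∉I = ⊥-elim (<-irrefl refl (<-≤-trans b<∣X∣ (begin
  ∣ X ∣                               ≤⟨ ∣F∣≤maxFaceSize (NonFaceComplexFace? I) X∉I ⟩
  maxFaceSize (NonFaceComplexFace? I) ≡⟨ quasiF⇒maxFaceSize-≡ {I = I} quasi ⟩
  maxFaceSize (FacetComplexFace? I)   ≤⟨ maxFaceSize≤ (FacetComplexFace? I) bound ⟩
  _                                   ∎)))
  where open Data.Nat.Properties.≤-Reasoning

module _ (Δ : SimplicialComplex n) where

  ∈facetIdeal⇒⊇facet : {X : Subset n} → X ∈ᴵ facetIdeal Δ → ∃[ G ] (IsFacet Δ G × G ⊆ X)
  ∈facetIdeal⇒⊇facet X∈I with find X∈I
  ... | G , G∈ , G⊆X = G , proj₂ (∈-filter⁻ (IsFacet? Δ) {xs = allSubsets n} G∈) , G⊆X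

  facet⇒∈facetIdeal : {G : Subset n} → IsFacet Δ G → G ∈ᴵ facetIdeal Δ
  facet⇒∈facetIdeal {G} fG = lose (∈-filter⁺ (IsFacet? Δ) (∈-allSubsets G) fG) (λ x∈ → x∈)

  -- A minimal generator contains the generator x_H of a facet H, so equals it.
  facetComplexFace⇒⊆facet : {F : Subset n} → FacetComplexFace (facetIdeal Δ) F →
                            ∃[ G ] (IsFacet Δ G × F ⊆ G)
  facetComplexFace⇒⊆facet (G , (G∈I , minimal) , F⊆G) with ∈facetIdeal⇒⊇facet G∈I
  ... | H , fH , H⊆G with minimal H (facet⇒∈facetIdeal fH) H⊆G
  ... | refl = H , fH , F⊆G

  quasiF-pure⇒large-⊇facet : {d : ℕ} → IsPureOfDim Δ d → IsQuasiFSimplicialComplex Δ →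
    (X : Subset n) → suc d < ∣ X ∣ → ∃[ G ] (IsFacet Δ G × G ⊆ X)
  quasiF-pure⇒large-⊇facet (_ , facetSize) quasi X d+1<∣X∣ =
    ∈facetIdeal⇒⊇facet (quasiF⇒large-∈ᴵ quasi facetComplexFace-size X d+1<∣X∣)
    where
      facetComplexFace-size : ∀ {F} → FacetComplexFace (facetIdeal Δ) F → ∣ F ∣ ≤ _
      facetComplexFace-size F∈ with facetComplexFace⇒⊆facet F∈
      ... | G , fG , F⊆G = ≤-trans (p⊆q⇒∣p∣≤∣q∣ F⊆G) (≤-reflexive (facetSize G fG))

module _ (Δ : SimplicialComplex n) {d : ℕ} (1<d : 1 < d)
         (facetSize : ∀ G → IsFacet Δ G → ∣ G ∣ ≡ suc d)
         (large-⊇facet : ∀ X → suc d < ∣ X ∣ → ∃[ G ] (IsFacet Δ G × G ⊆ X)) where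

  d≤∣F-x∣ : {F : Subset n} (x : Fin n) → IsFacet Δ F → d ≤ ∣ F - x ∣
  d≤∣F-x∣ {F} x fF = ≤-pred (subst (_≤ suc ∣ F - x ∣) (facetSize F fF) (∣p∣≤1+∣p-x∣ F x))

  ∣F-x∣<∣G∣ : {F G : Subset n} {x : Fin n} → x ∈ F → IsFacet Δ F → IsFacet Δ G → ∣ F - x ∣ < ∣ G ∣
  ∣F-x∣<∣G∣ {F} {G} x∈F fF fG =
    subst (_ <_) (trans (facetSize F fF) (sym (facetSize G fG))) (x∈p⇒∣p-x∣<∣p∣ x∈F)

  d+1<∣F-x∪F'-y∣ : {F F' : Subset n} (x y : Fin n) → IsFacet Δ F → IsFacet Δ F' → Empty (F ∩ F') →
                   suc d < ∣ (F - x) ∪ (F' - y) ∣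
  d+1<∣F-x∪F'-y∣ {F} {F'} x y fF fF' F∩F'=∅ = begin
    suc (suc d)             ≡⟨ +-comm 2 d ⟩
    d + 2                   ≤⟨ +-monoʳ-≤ d 1<d ⟩
    d + d                   ≤⟨ +-mono-≤ (d≤∣F-x∣ x fF) (d≤∣F-x∣ y fF') ⟩
    ∣ F - x ∣ + ∣ F' - y ∣  ≤⟨ ∣p∣+∣q∣≤∣p∪q∣ (F - x) (F' - y) removals-disjoint ⟩
    ∣ (F - x) ∪ (F' - y) ∣  ∎
    where
      open Data.Nat.Properties.≤-Reasoning
      removals-disjoint : Empty ((F - x) ∩ (F' - y))
      removals-disjoint (i , i∈) with x∈p∩q⁻ (F - x) (F' - y) i∈
      ... | i∈F-x , i∈F'-y = F∩F'=∅ (i , x∈p∩q⁺ (p─q⊆p F _ i∈F-x , p─q⊆p F' _ i∈F'-y))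

  ⊆F-x∪F'-y⇒meets : {F F' G : Subset n} {x y : Fin n} → IsFacet Δ F → IsFacet Δ F' → IsFacet Δ G →
                    x ∈ F → y ∈ F' → G ⊆ (F - x) ∪ (F' - y) → Meet F G × Meet G F'
  ⊆F-x∪F'-y⇒meets {F} {F'} {G} {x} {y} fF fF' fG x∈F y∈F' G⊆ = meetF , meetF'
    where
      meetF : Meet F G
      meetF with ⊆∪-∣p∣<⇒meets (F' - y) (F - x) G (subst (G ⊆_) (∪-comm (F - x) (F' - y)) G⊆)
                                (∣F-x∣<∣G∣ y∈F' fF' fG)
      ... | i , i∈ with x∈p∩q⁻ G (F - x) i∈
      ... | i∈G , i∈F-x = i , p─q⊆p F _ i∈F-x , i∈G
      meetF' : Meet G F'
      meetF' with ⊆∪-∣p∣<⇒meets (F - x) (F' - y) G G⊆ (∣F-x∣<∣G∣ x∈F fF fG)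
      ... | i , i∈ with x∈p∩q⁻ G (F' - y) i∈
      ... | i∈G , i∈F'-y = i , i∈G , p─q⊆p F' _ i∈F'-y

  facet-Nonempty : {F : Subset n} → IsFacet Δ F → Nonempty F
  facet-Nonempty {F} fF = 0<∣p∣⇒Nonempty F (subst (0 <_) (sym (facetSize F fF)) (s≤s z≤n))

  disjointFacets⇒bridge : {F F' : Subset n} → IsFacet Δ F → IsFacet Δ F' → Empty (F ∩ F') →
                          ∃[ G ] (IsFacet Δ G × Meet F G × Meet G F')
  disjointFacets⇒bridge {F} {F'} fF fF' F∩F'=∅ with facet-Nonempty fF | facet-Nonempty fF'
  ... | x , x∈F | y , y∈F' with large-⊇facet ((F - x) ∪ (F' - y)) (d+1<∣F-x∪F'-y∣ x y fF fF' F∩F'=∅)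
  ... | G , fG , G⊆ = G , fG , ⊆F-x∪F'-y⇒meets fF fF' fG x∈F y∈F' G⊆

theorem4p1 : (n : ℕ) (Δ : SimplicialComplex n) (d : ℕ) →
    IsPureOfDim Δ d → 1 < d → IsQuasiFSimplicialComplex Δ → Connected Δ
theorem4p1 n Δ d pure 1<d quasi F F' fF fF' with nonempty? (F ∩ F')
... | yes (v , v∈F∩F') = step fF' (v , x∈p∩q⁻ F F' v∈F∩F') stop
... | no  F∩F'=∅
  with disjointFacets⇒bridge Δ 1<d (proj₂ pure) (quasiF-pure⇒large-⊇facet Δ pure quasi) fF fF' F∩F'=∅
... | G , fG , meetF , meetF' = step fG meetF (step fF' meetF' stop)
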